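{- Let $\mathcal{J}$ be a small category. For every functor $F:\mathcal{J}\to\mathsf{Set}$, the covariant isotropy group $\mathcal{Z}(F)$ of $F$ in $\mathsf{Set}^{\mathcal{J}}$ is isomorphic to $\mathsf{Aut}(\mathsf{Id}_{\mathcal{J}})$; hence the covariant isotropy group functor of $\mathsf{Set}^{\mathcal{J}}$ is constant on $\mathsf{Aut}(\mathsf{Id}_{\mathcal{J}})$.
   Context: $\mathsf{Set}^{\mathcal{J}}$ is the category of functors $\mathcal{J}\to\mathsf{Set}$ and natural transformations. For a category $\mathcal{E}$ and object $X$, the covariant isotropy group $\mathcal{Z}(X)$ is the group of natural automorphisms of the projection functor $X/\mathcal{E}\to\mathcal{E}$, i.e. families of automorphisms $\alpha_m:Y\to Y$ for $m:X\to Y$ with $\alpha_{nm}\circ n=n\circ\alpha_m$ for all $n:Y\to Z$; this is functorial in $X$. $\mathsf{Aut}(\mathsf{Id}_{\mathcal{J}})$ is the group of natural automorphisms of the identity functor of $\mathcal{J}$. -}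

module Defs where

open import Level using (0ℓ) renaming (suc to lsuc)
open import Function using (_∘′_)
open import Relation.Binary.PropositionalEquality
open import Relation.Binary.Structures using (IsEquivalence)
open import Algebra.Bundles using (Group)
open import Algebra.Structures using (IsGroup; IsMonoid; IsSemigroup; IsMagma)
open import Data.Product using (_,_)

record Category : Set₁ where
  infixr 9 _∘_
  field
    Ob    : Set
    Hom   : Ob → Ob → Set
    id    : ∀ {a} → Hom a a
    _∘_   : ∀ {a b c} → Hom b c → Hom a b → Hom a c
    idˡ   : ∀ {a b} (f : Hom a b) → id ∘ f ≡ f
    idʳ   : ∀ {a b} (f : Hom a b) → f ∘ id ≡ f
    assoc : ∀ {a b c d} (h : Hom c d) (g : Hom b c) (f : Hom a b) →
            (h ∘ g) ∘ f ≡ h ∘ (g ∘ f)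

module _ (J : Category) where
  open Category J

  record AutId : Set where
    field
      θ       : ∀ a → Hom a a
      θ⁻¹     : ∀ a → Hom a a
      invˡ    : ∀ a → θ⁻¹ a ∘ θ a ≡ id
      invʳ    : ∀ a → θ a ∘ θ⁻¹ a ≡ id
      natural : ∀ {a b} (f : Hom a b) → θ b ∘ f ≡ f ∘ θ a
  open AutId

  _≈A_ : AutId → AutId → Set
  s ≈A t = ∀ a → θ s a ≡ θ t a

  private
    cancelInv : ∀ {a b c} (x : Hom b c) (y : Hom c b) (f : Hom a b) →
                y ∘ x ≡ id → y ∘ (x ∘ f) ≡ f
    cancelInv x y f p = trans (sym (assoc y x f)) (trans (cong (_∘ f) p) (idˡ f))

  natural⁻¹ : (s : AutId) → ∀ {a b} (f : Hom a b) → θ⁻¹ s b ∘ f ≡ f ∘ θ⁻¹ s a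
  natural⁻¹ s {a} {b} f =
    trans (cong (θ⁻¹ s b ∘_) (sym (trans (cong (f ∘_) (invʳ s a)) (idʳ f))))
    (trans (cong (θ⁻¹ s b ∘_) (sym (assoc f (θ s a) (θ⁻¹ s a))))
    (trans (cong (λ k → θ⁻¹ s b ∘ (k ∘ θ⁻¹ s a)) (sym (natural s f)))
    (trans (cong (θ⁻¹ s b ∘_) (assoc (θ s b) f (θ⁻¹ s a)))
      (cancelInv (θ s b) (θ⁻¹ s b) (f ∘ θ⁻¹ s a) (invˡ s b)))))

  _·A_ : AutId → AutId → AutId
  θ (s ·A t) a = θ s a ∘ θ t a
  θ⁻¹ (s ·A t) a = θ⁻¹ t a ∘ θ⁻¹ s a
  invˡ (s ·A t) a =
    trans (assoc _ _ _) (trans (cong (θ⁻¹ t a ∘_) (cancelInv (θ s a) (θ⁻¹ s a) _ (invˡ s a))) (invˡ t a))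
  invʳ (s ·A t) a =
    trans (assoc _ _ _) (trans (cong (θ s a ∘_) (cancelInv (θ⁻¹ t a) (θ t a) _ (invʳ t a))) (invʳ s a))
  natural (s ·A t) {a} {b} f =
    trans (assoc _ _ _) (trans (cong (θ s b ∘_) (natural t f))
    (trans (sym (assoc _ _ _)) (trans (cong (_∘ θ t a) (natural s f)) (assoc _ _ _))))

  εA : AutId
  θ εA a = id
  θ⁻¹ εA a = id
  invˡ εA a = idˡ id
  invʳ εA a = idˡ id
  natural εA f = trans (idˡ f) (sym (idʳ f))

  _⁻¹A : AutId → AutId
  θ (s ⁻¹A) = θ⁻¹ s
  θ⁻¹ (s ⁻¹A) = θ s
  invˡ (s ⁻¹A) = invʳ s
  invʳ (s ⁻¹A) = invˡ s
  natural (s ⁻¹A) = natural⁻¹ s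

  private
    uniqInv : ∀ {a} (x x' y y' : Hom a a) → x ≡ x' → y ∘ x ≡ id → x' ∘ y' ≡ id → y ≡ y'
    uniqInv x x' y y' p l r =
      trans (sym (idʳ y)) (trans (cong (y ∘_) (sym r))
      (trans (cong (λ k → y ∘ (k ∘ y')) (sym p))
      (trans (sym (assoc y x y')) (trans (cong (_∘ y') l) (idˡ y')))))

  AutIdGroup : Group 0ℓ 0ℓ
  AutIdGroup = record
    { Carrier = AutId ; _≈_ = _≈A_ ; _∙_ = _·A_ ; ε = εA ; _⁻¹ = _⁻¹A
    ; isGroup = record
      { isMonoid = record
        { isSemigroup = record
          { isMagma = record
            { isEquivalence = record
              { refl = λ a → refl ; sym = λ p a → sym (p a) ; trans = λ p q a → trans (p a) (q a) }
            ; ∙-cong = λ p q a → cong₂ _∘_ (p a) (q a) }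
          ; assoc = λ s t u a → assoc _ _ _ }
        ; identity = (λ s a → idˡ _) , (λ s a → idʳ _) }
      ; inverse = (λ s a → invˡ s a) , (λ s a → invʳ s a)
      ; ⁻¹-cong = λ {s} {t} p a → uniqInv (θ s a) (θ t a) (θ⁻¹ s a) (θ⁻¹ t a) (p a) (invˡ s a) (invʳ t a) } }

  record Functor : Set₁ where
    field
      F₀   : Ob → Set
      F₁   : ∀ {a b} → Hom a b → F₀ a → F₀ b
      F-id : ∀ {a} (x : F₀ a) → F₁ id x ≡ x
      F-∘  : ∀ {a b c} (g : Hom b c) (f : Hom a b) (x : F₀ a) →
             F₁ (g ∘ f) x ≡ F₁ g (F₁ f x)
  open Functor

  record NatTrans (F G : Functor) : Set where
    field
      η       : ∀ a → F₀ F a → F₀ G a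
      natural : ∀ {a b} (f : Hom a b) (x : F₀ F a) → η b (F₁ F f x) ≡ F₁ G f (η a x)
  open NatTrans

  _≈N_ : ∀ {F G} → NatTrans F G → NatTrans F G → Set
  m ≈N n = ∀ a x → η m a x ≡ η n a x

  idN : ∀ {F} → NatTrans F F
  η idN a x = x
  natural idN f x = refl

  _∘N_ : ∀ {F G H} → NatTrans G H → NatTrans F G → NatTrans F H
  η (n ∘N m) a = η n a ∘′ η m a
  natural (n ∘N m) f x = trans (cong (η n _) (natural m f x)) (natural n f (η m _ x))

  record Auto (G : Functor) : Set where
    field
      to    : NatTrans G G
      from  : NatTrans G G
      invˡ  : (from ∘N to) ≈N idN
      invʳ  : (to ∘N from) ≈N idN
  open Auto

  -- Covariant isotropy group Z(F) of F in Set^J: natural automorphisms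
  -- of the projection functor F/Set^J → Set^J.

  record Isotropy (F : Functor) : Set₁ where
    field
      α       : ∀ {G} (m : NatTrans F G) → Auto G
      α-resp  : ∀ {G} {m m' : NatTrans F G} → m ≈N m' → to (α m) ≈N to (α m')
      natural : ∀ {G H} (m : NatTrans F G) (n : NatTrans G H) →
                (to (α (n ∘N m)) ∘N n) ≈N (n ∘N to (α m))
  open Isotropy

  module _ (F : Functor) where

    _≈Z_ : Isotropy F → Isotropy F → Set₁
    s ≈Z t = ∀ {G} (m : NatTrans F G) → to (α s m) ≈N to (α t m)

    private
      autoMul : ∀ {G} → Auto G → Auto G → Auto G
      to (autoMul p q) = to p ∘N to q
      from (autoMul p q) = from q ∘N from p
      invˡ (autoMul p q) a x =
        trans (cong (η (from q) a) (invˡ p a (η (to q) a x))) (invˡ q a x)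
      invʳ (autoMul p q) a x =
        trans (cong (η (to p) a) (invʳ q a (η (from p) a x))) (invʳ p a x)

      autoInv : ∀ {G} → Auto G → Auto G
      to (autoInv p) = from p
      from (autoInv p) = to p
      invˡ (autoInv p) = invʳ p
      invʳ (autoInv p) = invˡ p

      fromUniq : ∀ {G} (p q : Auto G) → to p ≈N to q → from p ≈N from q
      fromUniq p q e a y =
        trans (cong (η (from p) a) (sym (invʳ q a y)))
        (trans (cong (η (from p) a) (sym (e a (η (from q) a y))))
          (invˡ p a (η (from q) a y)))

    _·Z_ : Isotropy F → Isotropy F → Isotropy F
    α (s ·Z t) m = autoMul (α s m) (α t m)
    α-resp (s ·Z t) e a x =
      trans (cong (η (to (α s _)) a) (α-resp t e a x)) (α-resp s e a _)
    natural (s ·Z t) m n a x =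
      trans (cong (η (to (α s (n ∘N m))) a) (natural t m n a x)) (natural s m n a _)

    εZ : Isotropy F
    α εZ m = record { to = idN ; from = idN ; invˡ = λ a x → refl ; invʳ = λ a x → refl }
    α-resp εZ e a x = refl
    natural εZ m n a x = refl

    _⁻¹Z : Isotropy F → Isotropy F
    α (s ⁻¹Z) m = autoInv (α s m)
    α-resp (s ⁻¹Z) {m = m} {m'} e = fromUniq (α s m) (α s m') (α-resp s e)
    natural (s ⁻¹Z) m n a x =
      trans (cong (λ z → η (from (α s (n ∘N m))) a (η n a z)) (sym (invʳ (α s m) a x)))
      (trans (cong (η (from (α s (n ∘N m))) a) (sym (natural s m n a (η (from (α s m)) a x))))
        (invˡ (α s (n ∘N m)) a _))

    IsotropyGroup : Group (lsuc 0ℓ) (lsuc 0ℓ)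
    IsotropyGroup = record
      { Carrier = Isotropy F ; _≈_ = _≈Z_ ; _∙_ = _·Z_ ; ε = εZ ; _⁻¹ = _⁻¹Z
      ; isGroup = record
        { isMonoid = record
          { isSemigroup = record
            { isMagma = record
              { isEquivalence = record
                { refl = λ m a x → refl
                ; sym = λ p m a x → sym (p m a x)
                ; trans = λ p q m a x → trans (p m a x) (q m a x) }
              ; ∙-cong = λ {s} {s'} {t} {t'} p q m a x →
                  trans (cong (η (to (α s m)) a) (q m a x)) (p m a _) }
            ; assoc = λ s t u m a x → refl }
          ; identity = (λ s m a x → refl) , (λ s m a x → refl) }
        ; inverse = (λ s m a x → invˡ (α s m) a x) , (λ s m a x → invʳ (α s m) a x)
        ; ⁻¹-cong = λ {s} {t} p m → fromUniq (α s m) (α t m) (p m) } }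

  ∘N-resp : ∀ {F G H} {m m' : NatTrans G H} (f : NatTrans F G) →
            m ≈N m' → (m ∘N f) ≈N (m' ∘N f)
  ∘N-resp f e a x = e a (η f a x)

  Zmap : ∀ {F F'} → NatTrans F F' → Isotropy F → Isotropy F'
  α (Zmap f s) m = α s (m ∘N f)
  α-resp (Zmap f s) {m = m} {m'} e = α-resp s {m = m ∘N f} {m' = m' ∘N f} (∘N-resp {m = m} {m' = m'} f e)
  natural (Zmap {F} {F'} f s) {G} {H} m n a x =
    trans (α-resp s {G = H} {m = (n ∘N m) ∘N f} {m' = n ∘N (m ∘N f)} (λ _ _ → refl) a (η n a x))
          (natural s (m ∘N f) n a x)

-- An element s of Z(F) is determined by what it does to the generic element
-- id ∈ y(a)(a) under the coprojection F → F ⊔ y(a).  That image lies in the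
-- y(a) summand, i.e. is some θ_a : a → a, because s must commute with the two
-- distinct maps F ⊔ y(a) → F ⊔ y(a) ⊔ y(a) which agree on F.  Every other
-- component of s is then forced, by naturality along the copairing
-- F ⊔ y(b) → G of m : F → G and x ∈ G(b), to be x ↦ G(θ_b)(x).  Hence
-- s ↦ θ is an isomorphism onto Aut(Id_J), and it is visibly unchanged by
-- precomposition along F → F'.
module Submission where

open import Defs
open import Data.Product using (Σ; _×_; _,_; proj₁; proj₂)
open import Data.Sum using (_⊎_; inj₁; inj₂)
open import Data.Sum.Properties using (inj₂-injective)
open import Data.Empty using (⊥; ⊥-elim)
open import Algebra.Bundles using (Group)
open import Algebra.Morphism.Structures using (module GroupMorphisms)
open import Relation.Binary.PropositionalEquality
open ≡-Reasoning

module _ (J : Category) where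
  open Category J
  open AutId
  open Functor
  open NatTrans
  open Auto
  open Isotropy

  -- F ⊔ y(a), where y(a) = Hom a _ is the representable functor
  Adjoin : Functor J → Ob → Functor J
  F₀ (Adjoin F a) b = F₀ F b ⊎ Hom a b
  F₁ (Adjoin F a) f (inj₁ x) = inj₁ (F₁ F f x)
  F₁ (Adjoin F a) f (inj₂ g) = inj₂ (f ∘ g)
  F-id (Adjoin F a) (inj₁ x) = cong inj₁ (F-id F x)
  F-id (Adjoin F a) (inj₂ g) = cong inj₂ (idˡ g)
  F-∘ (Adjoin F a) g f (inj₁ x) = cong inj₁ (F-∘ F g f x)
  F-∘ (Adjoin F a) g f (inj₂ h) = cong inj₂ (assoc g f h)

  inl : ∀ {F a} → NatTrans J F (Adjoin F a)
  η inl b x = inj₁ x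
  natural inl f x = refl

  copair : ∀ {F G b} (m : NatTrans J F G) (x : F₀ G b) → NatTrans J (Adjoin F b) G
  η (copair m x) c (inj₁ y) = η m c y
  η (copair {G = G} m x) c (inj₂ g) = F₁ G g x
  natural (copair m x) f (inj₁ y) = natural m f y
  natural (copair {G = G} m x) f (inj₂ g) = F-∘ G f g x

  to-injective : ∀ {G} (p : Auto J G) {b} {x y : F₀ G b} →
                 η (to p) b x ≡ η (to p) b y → x ≡ y
  to-injective p {b} {x} {y} e = begin
    x                            ≡⟨ sym (invˡ p b x) ⟩
    η (from p) b (η (to p) b x)  ≡⟨ cong (η (from p) b) e ⟩
    η (from p) b (η (to p) b y)  ≡⟨ invˡ p b y ⟩
    y                            ∎

  F₁-natural : (G : Functor J) (h : ∀ a → Hom a a) →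
               (∀ {a b} (f : Hom a b) → h b ∘ f ≡ f ∘ h a) → NatTrans J G G
  η (F₁-natural G h h-nat) a = F₁ G (h a)
  natural (F₁-natural G h h-nat) f x = begin
    F₁ G (h _) (F₁ G f x)  ≡⟨ sym (F-∘ G (h _) f x) ⟩
    F₁ G (h _ ∘ f) x       ≡⟨ cong (λ k → F₁ G k x) (h-nat f) ⟩
    F₁ G (f ∘ h _) x       ≡⟨ F-∘ G f (h _) x ⟩
    F₁ G f (F₁ G (h _) x)  ∎

  F₁-inverse : (G : Functor J) {a : Ob} {f g : Hom a a} → g ∘ f ≡ id →
               ∀ x → F₁ G g (F₁ G f x) ≡ x
  F₁-inverse G {f = f} {g} g∘f≡id x = begin
    F₁ G g (F₁ G f x)  ≡⟨ sym (F-∘ G g f x) ⟩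
    F₁ G (g ∘ f) x     ≡⟨ cong (λ k → F₁ G k x) g∘f≡id ⟩
    F₁ G id x          ≡⟨ F-id G x ⟩
    x                  ∎

  actOn : AutId J → (G : Functor J) → Auto J G
  to (actOn t G) = F₁-natural G (θ t) (natural t)
  from (actOn t G) = F₁-natural G (θ⁻¹ t) (natural⁻¹ J t)
  invˡ (actOn t G) a = F₁-inverse G (invˡ t a)
  invʳ (actOn t G) a = F₁-inverse G (invʳ t a)

  module _ {F : Functor J} where

    isotropy-equalizes :
      (s : Isotropy J F) {G H : Functor J} (m : NatTrans J F G)
      (n₁ n₂ : NatTrans J G H) → _≈N_ J (_∘N_ J n₁ m) (_∘N_ J n₂ m) →
      ∀ {b} (x : F₀ G b) (y : F₀ F b) → η (to (α s m)) b x ≡ η m b y →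
      η n₁ b x ≡ η n₂ b x
    isotropy-equalizes s m n₁ n₂ e {b} x y sx≡my = to-injective (α s (_∘N_ J n₁ m)) (begin
      η k₁ b (η n₁ b x)           ≡⟨ natural s m n₁ b x ⟩
      η n₁ b (η (to (α s m)) b x) ≡⟨ cong (η n₁ b) sx≡my ⟩
      η n₁ b (η m b y)            ≡⟨ e b y ⟩
      η n₂ b (η m b y)            ≡⟨ cong (η n₂ b) (sym sx≡my) ⟩
      η n₂ b (η (to (α s m)) b x) ≡⟨ sym (natural s m n₂ b x) ⟩
      η k₂ b (η n₂ b x)           ≡⟨ sym (α-resp s e b (η n₂ b x)) ⟩
      η k₁ b (η n₂ b x)           ∎)
      where
        k₁ = to (α s (_∘N_ J n₁ m))
        k₂ = to (α s (_∘N_ J n₂ m))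

    at-generic : Isotropy J F → (a : Ob) → F₀ (Adjoin F a) a
    at-generic s a = η (to (α s (inl {F} {a}))) a (inj₂ id)

    generic-image : (s : Isotropy J F) (a : Ob) →
                    Σ (Hom a a) λ h → at-generic s a ≡ inj₂ h
    generic-image s a with at-generic s a in eq
    ... | inj₂ h = h , refl
    ... | inj₁ y = ⊥-elim (summands-disjoint
          (isotropy-equalizes s inl inl (copair (_∘N_ J inl inl) (inj₂ id))
                              (λ _ _ → refl) (inj₂ id) y eq))
      where
        summands-disjoint :
          _≡_ {A = F₀ (Adjoin (Adjoin F a) a) a} (inj₁ (inj₂ id)) (inj₂ (id ∘ id)) → ⊥
        summands-disjoint ()

    θ-of : Isotropy J F → ∀ a → Hom a a
    θ-of s a = proj₁ (generic-image s a)

    θ-of-generic : (s : Isotropy J F) (a : Ob) →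
                   at-generic s a ≡ inj₂ (θ-of s a)
    θ-of-generic s a = proj₂ (generic-image s a)

    θ-of-unique : (s : Isotropy J F) {a : Ob} {h : Hom a a} →
                  at-generic s a ≡ inj₂ h → θ-of s a ≡ h
    θ-of-unique s {a} e = inj₂-injective (trans (sym (θ-of-generic s a)) e)

    isotropy-acts-by-θ : (s : Isotropy J F) {G : Functor J} (m : NatTrans J F G)
                         (b : Ob) (x : F₀ G b) →
                         η (to (α s m)) b x ≡ F₁ G (θ-of s b) x
    isotropy-acts-by-θ s {G} m b x = begin
      η (to (α s m)) b x                          ≡⟨ cong (η (to (α s m)) b) (sym (F-id G x)) ⟩
      η (to (α s m)) b (F₁ G id x)                ≡⟨ α-resp s (λ _ _ → refl) b (F₁ G id x) ⟩
      η (to (α s (_∘N_ J [m,x] inl))) b (η [m,x] b (inj₂ id))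
                                                  ≡⟨ natural s inl [m,x] b (inj₂ id) ⟩
      η [m,x] b (at-generic s b)                  ≡⟨ cong (η [m,x] b) (θ-of-generic s b) ⟩
      F₁ G (θ-of s b) x                           ∎
      where [m,x] = copair m x

    θ-of-unique-∘id : (s : Isotropy J F) {a : Ob} {h : Hom a a} →
                         at-generic s a ≡ inj₂ (h ∘ id) → θ-of s a ≡ h
    θ-of-unique-∘id s {h = h} e = θ-of-unique s (trans e (cong inj₂ (idʳ h)))

    θ-of-natural : (s : Isotropy J F) {a b : Ob} (f : Hom a b) →
                   θ-of s b ∘ f ≡ f ∘ θ-of s a
    θ-of-natural s {a} {b} f = inj₂-injective (begin
      inj₂ (θ-of s b ∘ f)                         ≡⟨ sym (isotropy-acts-by-θ s inl b (inj₂ f)) ⟩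
      η k b (inj₂ f)                              ≡⟨ cong (λ g → η k b (inj₂ g)) (sym (idʳ f)) ⟩
      η k b (F₁ (Adjoin F a) f (inj₂ id))         ≡⟨ natural k f (inj₂ id) ⟩
      F₁ (Adjoin F a) f (at-generic s a)          ≡⟨ cong (F₁ (Adjoin F a) f) (θ-of-generic s a) ⟩
      inj₂ (f ∘ θ-of s a)                         ∎)
      where
        k = to (α s (inl {F} {a}))

    θ-of-cong : {s t : Isotropy J F} → _≈Z_ J F s t → ∀ a → θ-of s a ≡ θ-of t a
    θ-of-cong {s} {t} e a = θ-of-unique s (trans (e inl a (inj₂ id)) (θ-of-generic t a))

    θ-of-homo : (s t : Isotropy J F) (a : Ob) →
                θ-of (_·Z_ J F s t) a ≡ θ-of s a ∘ θ-of t a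
    θ-of-homo s t a = θ-of-unique (_·Z_ J F s t) (begin
      η (to (α s ι)) a (at-generic t a)     ≡⟨ cong (η (to (α s ι)) a) (θ-of-generic t a) ⟩
      η (to (α s ι)) a (inj₂ (θ-of t a))    ≡⟨ isotropy-acts-by-θ s ι a _ ⟩
      inj₂ (θ-of s a ∘ θ-of t a)            ∎)
      where ι = inl {F} {a}

    θ-of-ε : (a : Ob) → θ-of (εZ J F) a ≡ id
    θ-of-ε a = θ-of-unique (εZ J F) refl

    θ-of-inverse : (s t : Isotropy J F) → _≈Z_ J F (_·Z_ J F s t) (εZ J F) →
                   ∀ a → θ-of s a ∘ θ-of t a ≡ id
    θ-of-inverse s t st≈ε a = begin
      θ-of s a ∘ θ-of t a     ≡⟨ sym (θ-of-homo s t a) ⟩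
      θ-of (_·Z_ J F s t) a   ≡⟨ θ-of-cong {_·Z_ J F s t} {εZ J F} st≈ε a ⟩
      θ-of (εZ J F) a         ≡⟨ θ-of-ε a ⟩
      id                      ∎

    θ-of-injective : {s t : Isotropy J F} → (∀ a → θ-of s a ≡ θ-of t a) → _≈Z_ J F s t
    θ-of-injective {s} {t} e {G} m b x = begin
      η (to (α s m)) b x  ≡⟨ isotropy-acts-by-θ s m b x ⟩
      F₁ G (θ-of s b) x   ≡⟨ cong (λ h → F₁ G h x) (e b) ⟩
      F₁ G (θ-of t b) x   ≡⟨ sym (isotropy-acts-by-θ t m b x) ⟩
      η (to (α t m)) b x  ∎

    toAutId : Isotropy J F → AutId J
    θ (toAutId s) = θ-of s
    θ⁻¹ (toAutId s) = θ-of (_⁻¹Z J F s)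
    invˡ (toAutId s) = θ-of-inverse (_⁻¹Z J F s) s (Group.inverseˡ (IsotropyGroup J F) s)
    invʳ (toAutId s) = θ-of-inverse s (_⁻¹Z J F s) (Group.inverseʳ (IsotropyGroup J F) s)
    natural (toAutId s) = θ-of-natural s

    fromAutId : AutId J → Isotropy J F
    α (fromAutId t) {G} m = actOn t G
    α-resp (fromAutId t) e b x = refl
    natural (fromAutId t) m n b x = sym (natural n (θ t b) x)

    toAutId-isGroupIsomorphism :
      GroupMorphisms.IsGroupIsomorphism
        (Group.rawGroup (IsotropyGroup J F)) (Group.rawGroup (AutIdGroup J)) toAutId
    toAutId-isGroupIsomorphism = record
      { isGroupMonomorphism = record
        { isGroupHomomorphism = record
          { isMonoidHomomorphism = record
            { isMagmaHomomorphism = record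
              { isRelHomomorphism = record { cong = θ-of-cong }
              ; homo = θ-of-homo }
            ; ε-homo = θ-of-ε }
          ; ⁻¹-homo = λ s a → refl }
        ; injective = θ-of-injective }
      ; surjective = λ t → fromAutId t , λ {s} e a →
          θ-of-unique-∘id s (e (inl {a = a}) a (inj₂ id)) }

  toAutId-Zmap : (F F' : Functor J) (f : NatTrans J F F') (s : Isotropy J F) →
                 _≈A_ J (toAutId (Zmap J f s)) (toAutId s)
  toAutId-Zmap F F' f s a =
    θ-of-unique-∘id (Zmap J f s) (isotropy-acts-by-θ s (_∘N_ J inl f) a (inj₂ id))

corollary22 : (J : Category) →
    Σ ((F : Functor J) → Isotropy J F → AutId J) (λ φ →
      ((F : Functor J) →
        GroupMorphisms.IsGroupIsomorphism
          (Group.rawGroup (IsotropyGroup J F)) (Group.rawGroup (AutIdGroup J)) (φ F))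
      × ((F F' : Functor J) (f : NatTrans J F F') (s : Isotropy J F) →
          _≈A_ J (φ F' (Zmap J f s)) (φ F s)))
corollary22 J =
  (λ F → toAutId J) , (λ F → toAutId-isGroupIsomorphism J) , toAutId-Zmap J
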